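{- Let $\overline{\mathsf{M}}$ be a complemented HMS model and $i\in I$. Then for all events $E,F\in\Sigma$ and $\{E_n\}_n\subseteq\Sigma$: (i) $L_i(S_\Phi^\uparrow)=S_\Phi^\uparrow$ for every $\Phi\subseteq\mathsf{At}$; (ii) $L_i(\bigcap_nE_n)=\bigcap_nL_i(E_n)$; (iii) $E\subseteq F$ implies $L_i(E)\subseteq L_i(F)$; (iv) $L_i(E)\subseteq E$; (v) $L_i(E)\subseteq L_iL_i(E)$; (vi) $\neg L_i(E)\subseteq L_i\neg L_i(E)$.
   Context: Fix a non-empty set $\mathsf{At}$. A complemented HMS model $\langle I,\{S_\Phi\}_{\Phi\subseteq\mathsf{At}},(r^\Phi_\Psi),(\Lambda_i)_{i\in I},(\Pi_i)_{i\in I},v\rangle$: $I\neq\emptyset$; non-empty pairwise disjoint spaces $S_\Phi$, ordered $S_{\Phi'}\succeq S_\Phi$ iff $\Phi\subseteq\Phi'$; $\Omega=\bigcup_\Phi S_\Phi$; surjections $r^\Phi_\Psi:S_\Phi\to S_\Psi$ ($\Psi\subseteq\Phi$), $r^\Phi_\Phi=\mathrm{id}$, $r^\Phi_\Upsilon=r^\Psi_\Upsilon\circ r^\Phi_\Psi$; $\omega_\Psi=r^\Phi_\Psi(\omega)$, $D_\Psi=D_{S_\Psi}=r^\Phi_\Psi(D)$, $D^\uparrow=\bigcup_{\Phi\subseteq\Psi}(r^\Psi_\Phi)^{ -1}(D)$ for $D\subseteq S_\Phi$. Events: $E=D^\uparrow$, base-space $S(E)=S_\Phi$, base $D$ (vacuous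 events $\emptyset^{S_\Phi}$ distinguished by base-space); $\Sigma$ = set of events; $\neg E=(S(E)\setminus D)^\uparrow$; conjunction = intersection. $\Pi_i:\Omega\to2^\Omega\setminus\{\emptyset\}$: Confinement ($\omega\in S_\Phi\Rightarrow\Pi_i(\omega)\subseteq S_\Psi$ for some $\Psi\subseteq\Phi$, denoted $S_{\Pi_i(\omega)}$), Generalized Reflexivity ($\omega\in\Pi_i(\omega)^\uparrow$), Stationarity, Projections Preserve Ignorance ($\omega\in S_\Phi$, $\Psi\subseteq\Phi\Rightarrow\Pi_i(\omega)^\uparrow\subseteq\Pi_i(\omega_\Psi)^\uparrow$), Projections Preserve Knowledge ($\Upsilon\subseteq\Psi\subseteq\Phi$, $\omega\in S_\Phi$, $\Pi_i(\omega)\subseteq S_\Psi\Rightarrow\Pi_i(\omega)_\Upsilon=\Pi_i(\omega_\Upsilon)$). $\Lambda_i:\Omega\to2^\Omega$: Reflexivity ($\omega\in\Lambda_i(\omega)$), Stationarity ($\omega'\in\Lambda_i(\omega)\Rightarrow\Lambda_i(\omega')=\Lambda_i(\omega)$), Projections Preserve Implicit Knowledge ($\omega\in S_\Phi$, $\Psi\subseteq\Phi\Rightarrow\Lambda_i(\omega)_\Psi=\Lambda_i(\omega_\Psi)$), Explicit Measurability ($\omega'\in\Lambda_i(\omega)\Rightarrow\Pi_i(\omega')=\Pi_i(\omega)$), Implicit Measurability ($\omega'\in\Pi_i(\omega)\Rightarrow\Lambda_i(\omega')=\Lambda_i(\omega)_{S_{\Pi_i(\omega)}}$). Implicit knowledge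 operator: $L_i(E)=\{\omega\in\Omega:\Lambda_i(\omega)\subseteq E\}$ if this set is non-empty, and $L_i(E)=\emptyset^{S(E)}$ otherwise. -}

module Defs where

open import Level using (0ℓ; suc)
open import Data.Unit.Polymorphic using (⊤)
open import Data.Nat using (ℕ)
open import Data.Product using (Σ; Σ-syntax; ∃; _×_; _,_; proj₁; proj₂)
open import Relation.Binary.PropositionalEquality using (_≡_; subst)
open import Relation.Unary using (Pred; _⊆_; ∁)

Sub : Set → Set₁
Sub At = Pred At 0ℓ

ℓ₁ : Level.Level
ℓ₁ = suc 0ℓ

_≐_ : ∀ {A : Set₁} → Pred A ℓ₁ → Pred A ℓ₁ → Set₁
P ≐ Q = (P ⊆ Q) × (Q ⊆ P)
infix 4 _≐_

-- Spaces are pairwise disjoint automatically (Ω is a dependent sum).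
-- The inclusion proof argument of r is irrelevant, so r^Φ_Ψ depends only on Φ, Ψ.
record Spaces (At : Set) : Set₁ where
  field
    S        : Sub At → Set
    S-inh    : (Φ : Sub At) → S Φ
    r        : ∀ {Φ Ψ : Sub At} → .(Ψ ⊆ Φ) → S Φ → S Ψ
    r-surj   : ∀ {Φ Ψ : Sub At} .(p : Ψ ⊆ Φ) (t : S Ψ) → ∃ λ (s : S Φ) → r p s ≡ t
    r-id     : ∀ {Φ : Sub At} (s : S Φ) → r {Φ} {Φ} (λ {a} x → x) s ≡ s
    r-comp   : ∀ {Φ Ψ Υ : Sub At} .(p : Ψ ⊆ Φ) .(q : Υ ⊆ Ψ) (s : S Φ) →
               r {Φ} {Υ} (λ {a} x → p (q x)) s ≡ r q (r p s)

  Ω : Set₁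
  Ω = Σ (Sub At) S

  base : Ω → Sub At
  base = proj₁

  proj : (ω : Ω) {Ψ : Sub At} → Ψ ⊆ base ω → Ω
  proj (Φ , s) {Ψ} p = Ψ , r p s

  up : {Φ : Sub At} → Pred (S Φ) ℓ₁ → Pred Ω ℓ₁
  up {Φ} D (Ψ , t) = Σ (Φ ⊆ Ψ) λ p → D (r p t)

  -- the whole space S_Φ as a subset of itself, so S_Φ^↑ = up (full Φ)
  full : (Φ : Sub At) → Pred (S Φ) ℓ₁
  full Φ _ = ⊤

  -- P^↑ for an arbitrary subset P ⊆ Ω (agrees with `up` when P lies in one space)
  upΩ : Pred Ω ℓ₁ → Pred Ω ℓ₁
  upΩ P (Ψ , t) = Σ (Sub At) λ Φ → Σ (Φ ⊆ Ψ) λ p → P (Φ , r p t)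

  -- D_Υ = r^Ψ_Υ(D) for a subset D ⊆ Ω (of a single space S_Ψ with Υ ⊆ Ψ),
  -- viewed again as a subset of Ω (lying in S_Υ).
  projΩ : Sub At → Pred Ω ℓ₁ → Pred Ω ℓ₁
  projΩ Υ P (Υ' , t) =
    Σ (Υ' ≡ Υ) λ e → Σ Ω λ ω → P ω × Σ (Υ ⊆ base ω) λ q → r q (proj₂ ω) ≡ subst S e t

  -- Events: E = D^↑ with base-space S(E) = S_Φ and base D ⊆ S_Φ.
  -- An event is represented by its base-space index and its base.
  Event : Set₂
  Event = Σ (Sub At) λ Φ → Pred (S Φ) ℓ₁

  ⟦_⟧ : Event → Pred Ω ℓ₁
  ⟦ Φ , D ⟧ = up D

  neg : Event → Event
  neg (Φ , D) = Φ , ∁ D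

record HMS (At : Set) : Set₂ where
  field
    sp : Spaces At
  open Spaces sp public
  field
    I      : Set
    I-inh  : I
    Π        : I → Ω → Pred Ω ℓ₁
    Π-ne     : ∀ i ω → ∃ λ ω' → Π i ω ω'
    -- Confinement: Π_i(ω) ⊆ S_Ψ for some Ψ ⊆ Φ  (this Ψ is S_{Π_i(ω)})
    ΠΨ       : I → Ω → Sub At
    ΠΨ⊆      : ∀ i ω → ΠΨ i ω ⊆ base ω
    Π-conf   : ∀ i ω ω' → Π i ω ω' → base ω' ≡ ΠΨ i ω
    Π-grefl  : ∀ i ω → upΩ (Π i ω) ω
    Π-stat   : ∀ i ω ω' → Π i ω ω' → Π i ω' ≐ Π i ω
    Π-PPI    : ∀ i ω {Ψ} (p : Ψ ⊆ base ω) → upΩ (Π i ω) ⊆ upΩ (Π i (proj ω p))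
    Π-PPK    : ∀ i ω {Ψ Υ} (q : Υ ⊆ Ψ) (p : Ψ ⊆ base ω) →
               (∀ ω' → Π i ω ω' → base ω' ≡ Ψ) →
               projΩ Υ (Π i ω) ≐ Π i (proj ω (λ {a} x → p (q x)))
    Λ        : I → Ω → Pred Ω ℓ₁
    Λ-refl   : ∀ i ω → Λ i ω ω
    Λ-stat   : ∀ i ω ω' → Λ i ω ω' → Λ i ω' ≐ Λ i ω
    Λ-PPIK   : ∀ i ω {Ψ} (p : Ψ ⊆ base ω) → projΩ Ψ (Λ i ω) ≐ Λ i (proj ω p)
    Λ-expl   : ∀ i ω ω' → Λ i ω ω' → Π i ω' ≐ Π i ω
    Λ-impl   : ∀ i ω ω' → Π i ω ω' → Λ i ω' ≐ projΩ (ΠΨ i ω) (Λ i ω)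
    -- valuation (plays no role in the proposition)
    v        : At → Event

  -- Underlying subset of Ω of the implicit knowledge event L_i(E):
  -- {ω : Λ_i(ω) ⊆ E}.  (In the vacuous case the paper's L_i(E) = ∅^{S(E)},
  -- whose underlying set is again this (empty) set; the base-space tag is
  -- handled explicitly in the statement where it matters, namely in (vi).)
  L : I → Pred Ω ℓ₁ → Pred Ω ℓ₁
  L i E ω = Λ i ω ⊆ E

  ⋂ : (ℕ → Pred Ω ℓ₁) → Pred Ω ℓ₁
  ⋂ E ω = ∀ n → E n ω

{-# OPTIONS --safe #-}

-- Reflexivity and Stationarity make Λ_i an equivalence relation, and Projections
-- Preserve Implicit Knowledge (projecting onto the space of ω itself) keeps every
-- Λ_i-class inside a single space. L_i is the box operator of this relation, so
-- (ii)–(v) are the S5 laws, while (i) and (vi) hold because S_Φ^↑ and ¬L_i(E)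
-- are unions of Λ_i-classes, and every such union is contained in its own L_i.
module Submission where

open import Defs
open import Data.Nat using (ℕ)
open import Data.Product using (∃; _×_; _,_; proj₁; proj₂)
open import Relation.Nullary using (¬_)
open import Relation.Unary using (Pred; _⊆_; ∁)
open import Relation.Binary.Definitions using (_Respects_)
open import Relation.Binary.PropositionalEquality using (_≡_; sym; subst)

module ImplicitKnowledge {At : Set} (M : HMS At) (i : HMS.I M) where
  open HMS M

  Λ-sym : ∀ {ω ω'} → Λ i ω ω' → Λ i ω' ω
  Λ-sym {ω} {ω'} l = proj₂ (Λ-stat i ω ω' l) (Λ-refl i ω)

  Λ-base : ∀ {ω ω'} → Λ i ω ω' → base ω' ≡ base ω
  Λ-base {Φ , s} {ω'} l = proj₁ (proj₂ (Λ-PPIK i (Φ , s) (λ x → x)) l-id)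
    where
    l-id : Λ i (Φ , r (λ x → x) s) ω'
    l-id = subst (λ t → Λ i (Φ , t) ω') (sym (r-id s)) l

  ≐-sym : ∀ {P Q : Pred Ω ℓ₁} → P ≐ Q → Q ≐ P
  ≐-sym (P⊆Q , Q⊆P) = Q⊆P , P⊆Q

  L-mono : ∀ {P Q : Pred Ω ℓ₁} → P ⊆ Q → L i P ⊆ L i Q
  L-mono P⊆Q LP l = P⊆Q (LP l)

  L-⋂ : (P : ℕ → Pred Ω ℓ₁) → L i (⋂ P) ≐ ⋂ (λ n → L i (P n))
  L-⋂ P = (λ L⋂P n l → L⋂P l n) , (λ ⋂LP l n → ⋂LP n l)

  L-truth : ∀ {P : Pred Ω ℓ₁} → L i P ⊆ P
  L-truth {x = ω} LP = LP (Λ-refl i ω)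

  respects⇒⊆L : ∀ {P : Pred Ω ℓ₁} → P Respects Λ i → P ⊆ L i P
  respects⇒⊆L resp Pω l = resp l Pω

  respects⇒L-fixed : ∀ {P : Pred Ω ℓ₁} → P Respects Λ i → L i P ≐ P
  respects⇒L-fixed resp = L-truth , respects⇒⊆L resp

  L-respects : ∀ {P : Pred Ω ℓ₁} → L i P Respects Λ i
  L-respects {x = ω} {ω'} l LPω l' = LPω (proj₁ (Λ-stat i ω ω' l) l')

  respects-≐ : ∀ {P Q : Pred Ω ℓ₁} → P ≐ Q → P Respects Λ i → Q Respects Λ i
  respects-≐ (P⊆Q , Q⊆P) resp l Qω = P⊆Q (resp l (Q⊆P Qω))

  base⊇-respects : ∀ {Φ : Sub At} → (λ ω → Φ ⊆ base ω) Respects Λ i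
  base⊇-respects l Φ⊆ω = subst (_ ⊆_) (sym (Λ-base l)) Φ⊆ω

  up-full-respects : ∀ {Φ : Sub At} → up (full Φ) Respects Λ i
  up-full-respects l (Φ⊆ω , _) = base⊇-respects l Φ⊆ω , _

  -- The inclusion argument of r is irrelevant, so a witness of D at ω obtained
  -- through any proof of Ψ ⊆ base ω refutes ¬ D there.
  up-∁-respects : ∀ {Ψ : Sub At} {D : Pred (S Ψ) ℓ₁} →
                  up D Respects Λ i → up (∁ D) Respects Λ i
  up-∁-respects {Ψ} resp {y = ω'} l (Ψ⊆ω , ¬Dω) =
    Ψ⊆ω' , λ Dω' → ¬Dω (proj₂ (resp (Λ-sym l) (Ψ⊆ω' , Dω')))
    where
    Ψ⊆ω' : Ψ ⊆ base ω'
    Ψ⊆ω' = base⊇-respects l Ψ⊆ω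

proposition3 : {At : Set} → At → (M : HMS At) → (i : HMS.I M) →
    let open HMS M in
    -- (i)
    (∀ (Φ : Sub At) → L i (up (full Φ)) ≐ up (full Φ))
    -- (ii)
    × (∀ (E : ℕ → Event) → L i (⋂ (λ n → ⟦ E n ⟧)) ≐ ⋂ (λ n → L i ⟦ E n ⟧))
    -- (iii)
    × (∀ (E F : Event) → ⟦ E ⟧ ⊆ ⟦ F ⟧ → L i ⟦ E ⟧ ⊆ L i ⟦ F ⟧)
    -- (iv)
    × (∀ (E : Event) → L i ⟦ E ⟧ ⊆ ⟦ E ⟧)
    -- (v)
    × (∀ (E : Event) → L i ⟦ E ⟧ ⊆ L i (L i ⟦ E ⟧))
    -- (vi): for any event (Ψ , D') representing L_i(E), with base-space S(E)
    -- in the vacuous case, ¬L_i(E) ⊆ L_i(¬L_i(E))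
    × (∀ (E : Event) (Ψ : Sub At) (D' : Pred (S Ψ) ℓ₁) →
         up D' ≐ L i ⟦ E ⟧ →
         (¬ (∃ λ ω → L i ⟦ E ⟧ ω) → (proj₁ E ⊆ Ψ) × (Ψ ⊆ proj₁ E)) →
         ⟦ neg (Ψ , D') ⟧ ⊆ L i ⟦ neg (Ψ , D') ⟧)
proposition3 _ M i =
    (λ Φ → respects⇒L-fixed up-full-respects)
  , (λ E → L-⋂ (λ n → ⟦ E n ⟧))
  , (λ E F → L-mono)
  , (λ E → L-truth)
  , (λ E → respects⇒⊆L L-respects)
  -- The vacuous-case condition on the base-space is not needed: the inclusion
  -- holds for every event representing L_i(E).
  , λ E Ψ D' D'≐LE _ →
      respects⇒⊆L (up-∁-respects {D = D'} (respects-≐ (≐-sym D'≐LE) L-respects))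
  where
  open HMS M
  open ImplicitKnowledge M i
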